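{- Let $T\subseteq V$ be a set of conflicting nodes. The inequality $\sum_{a\in \check{A}^{ - }_{T}} y_a + \sum_{a\in \check{A}^{+}_{T}} y_a \geq \sum_{i\in T} z_i$ is valid for $\mathcal{P}$.
   Context: Let $G=(V,A)$ be a DAG with $V=\{1,\dots,n\}$ and $\check{A}\subseteq A$. Let $\bar{G}=(\bar V,\bar A)$ with $\bar V=\{0\}\cup V\cup\{\bar n\}$, $\bar n=n+1$, and $\bar A=\{(0,i):i\in V\}\cup A\cup\{(i,\bar n):i\in V\}$. For $S\subseteq\bar V$, $\delta^+(S)$ (resp. $\delta^-(S)$) denotes the arcs of $\bar A$ leaving (resp. entering) $S$. A path $(0,v_1,\dots,v_h,\bar n)$ in $\bar G$ is feasible if it traverses at least one arc of $\check{A}$, and infeasible otherwise. $\mathcal{P}$ is the convex hull of all binary vectors $y\in\{0,1\}^{|\bar A|}$ satisfying $\sum_{a\in\delta^-(i)}y_a\le 1$ and $\sum_{a\in\delta^-(i)}y_a=\sum_{a\in\delta^+(i)}y_a$ for all $i\in V$, and $\sum_{i=0}^h y_{(v_i,v_{i+1})}\le h$ for every infeasible path $(v_0=0,v_1,\dots,v_h,v_{h+1}=\bar n)$. For each node $i\in\bar V$, $\check{A}^{ - }_{i}$ is the set of arcs of $\check{A}$ from which there exists a path to $i$, and $\check{A}^{+}_{i}$ is the set of arcs of $\check{A}$ to which there exists a path from $i$. For $i\in V$, $z_i=\sum_{a\in\delta^-(i)}y_a$. Two nodes are conflicting if no path in $\bar G$ passes through both; a set of conflicting nodes is a set of pairwise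 conflicting nodes. $\check{A}^{ - }_{T}=\bigcup_{i\in T}\check{A}^{ - }_{i}$ and $\check{A}^{+}_{T}=\bigcup_{i\in T}\check{A}^{+}_{i}$.
   Formalization: The points y of 𝒫 are taken only as convex combinations with rational weights of the feasible binary vectors, rather than all points of the real convex hull. -}

module Defs where

open import Data.Nat using (ℕ; _≤_)
open import Data.Fin using (Fin)
open import Data.Fin.Subset using (Subset; _∈_)
open import Data.Fin.Subset.Properties using (_∈?_)
open import Data.Bool using (Bool; true; false; _∧_; if_then_else_)
open import Data.List using (List; []; _∷_; _++_; map; allFin; length; foldr)
open import Data.List.Relation.Unary.All using (All)
import Data.List.Membership.Propositional as LM
open import Data.Product using (Σ; ∃; _×_; _,_)
open import Data.Unit using (⊤)
open import Data.Empty using (⊥)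
open import Data.Rational as ℚ using (ℚ; 0ℚ; 1ℚ)
open import Relation.Nullary using (¬_; Dec; does)
open import Relation.Binary.PropositionalEquality using (_≡_; _≢_)
open import Relation.Binary.Construct.Closure.Transitive using (TransClosure)
open import Relation.Binary.Construct.Closure.ReflexiveTransitive using (Star)

-- Nodes of Ḡ: the source 0, the nodes V = {1..n} (as Fin n), the sink n̄.
data Node (n : ℕ) : Set where
  src   : Node n
  inner : Fin n → Node n
  snk   : Node n

nodes : ∀ {n} → List (Node n)
nodes {n} = src ∷ map inner (allFin n) ++ snk ∷ []

b2n : Bool → ℕ
b2n true  = 1
b2n false = 0

b2q : Bool → ℚ
b2q true  = 1ℚ
b2q false = 0ℚ

sumℕ : ∀ {X : Set} → List X → (X → ℕ) → ℕ
sumℕ xs f = foldr (λ x acc → f x Data.Nat.+ acc) 0 xs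

sumℚ : ∀ {X : Set} → List X → (X → ℚ) → ℚ
sumℚ xs f = foldr (λ x acc → f x ℚ.+ acc) 0ℚ xs

Acyclic : ∀ {n} → (Fin n → Fin n → Bool) → Set
Acyclic A = ∀ i → ¬ TransClosure (λ u v → A u v ≡ true) i i

module _ {n : ℕ} (A : Fin n → Fin n → Bool) where

  isArc : Node n → Node n → Bool
  isArc src       (inner _) = true
  isArc (inner i) (inner j) = A i j
  isArc (inner _) snk       = true
  isArc _         _         = false

  ArcR : Node n → Node n → Set
  ArcR u v = isArc u v ≡ true

  Reach : Node n → Node n → Set
  Reach = Star ArcR

  Chain : List (Node n) → Set
  Chain []            = ⊤
  Chain (_ ∷ [])      = ⊤
  Chain (u ∷ v ∷ rest) = ArcR u v × Chain (v ∷ rest)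

  pathNodes : List (Fin n) → List (Node n)
  pathNodes vs = src ∷ map inner vs ++ snk ∷ []

  STPath : List (Fin n) → Set
  STPath vs = Chain (pathNodes vs)

  -- Two distinct-node conflict: no 0-n̄ path of Ḡ passes through both
  -- (membership of inner i in (0,v_1..v_h,n̄) is membership of i in vs).
  Conflicting : Subset n → Set
  Conflicting T = ∀ i j → i ∈ T → j ∈ T → i ≢ j →
    ¬ (Σ (List (Fin n)) λ vs → STPath vs × (i LM.∈ vs) × (j LM.∈ vs))

  zval : (Node n → Node n → ℚ) → Fin n → ℚ
  zval y i = sumℚ nodes (λ u → if isArc u (inner i) then y u (inner i) else 0ℚ)

  module _ (Ac : Fin n → Fin n → Bool) where

    isCheck : Node n → Node n → Bool
    isCheck (inner i) (inner j) = Ac i j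
    isCheck _         _         = false

    NoCheck : List (Node n) → Set
    NoCheck []             = ⊤
    NoCheck (_ ∷ [])       = ⊤
    NoCheck (u ∷ v ∷ rest) = isCheck u v ≡ false × NoCheck (v ∷ rest)

    pathSum : (Node n → Node n → Bool) → List (Node n) → ℕ
    pathSum x []             = 0
    pathSum x (_ ∷ [])       = 0
    pathSum x (u ∷ v ∷ rest) = b2n (x u v) Data.Nat.+ pathSum x (v ∷ rest)

    inFlow : (Node n → Node n → Bool) → Fin n → ℕ
    inFlow x i = sumℕ nodes (λ u → b2n (isArc u (inner i) ∧ x u (inner i)))

    outFlow : (Node n → Node n → Bool) → Fin n → ℕ
    outFlow x i = sumℕ nodes (λ v → b2n (isArc (inner i) v ∧ x (inner i) v))

    -- binary vector (values on non-arcs are irrelevant) satisfying the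
    -- constraints defining 𝒫
    FeasibleBinary : (Node n → Node n → Bool) → Set
    FeasibleBinary x =
      (∀ i → inFlow x i ≤ 1) ×
      (∀ i → inFlow x i ≡ outFlow x i) ×
      (∀ vs → STPath vs → NoCheck (pathNodes vs) →
         pathSum x (pathNodes vs) ≤ length vs)

    InP : (Node n → Node n → ℚ) → Set
    InP y = Σ (List (ℚ × (Node n → Node n → Bool))) λ L →
      All (λ { (l , x) → (0ℚ ℚ.≤ l) × FeasibleBinary x }) L ×
      (sumℚ L (λ { (l , _) → l }) ≡ 1ℚ) ×
      (∀ u v → isArc u v ≡ true →
         y u v ≡ sumℚ L (λ { (l , x) → l ℚ.* b2q (x u v) }))

    InMinus : Subset n → Fin n → Fin n → Set
    InMinus T u v = ∃ λ t → t ∈ T × Reach (inner v) (inner t)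

    InPlus : Subset n → Fin n → Fin n → Set
    InPlus T u v = ∃ λ t → t ∈ T × Reach (inner t) (inner u)

    sumCheckWhere : {P : Fin n → Fin n → Set} → (∀ u v → Dec (P u v)) →
                    (Node n → Node n → ℚ) → ℚ
    sumCheckWhere dec y =
      sumℚ (allFin n) λ u → sumℚ (allFin n) λ v →
        if Ac u v ∧ does (dec u v) then y (inner u) (inner v) else 0ℚ

  zSum : Subset n → (Node n → Node n → ℚ) → ℚ
  zSum T y = sumℚ (allFin n) λ i → if does (i ∈? T) then zval y i else 0ℚ

{-# OPTIONS --safe #-}
module Submission where

-- Both sides are linear in y, so it suffices to check the inequality at a binary point x
-- of 𝒫, weighted by the nonnegative coefficients of a convex combination. At such an x,
-- in-degree at most one, flow conservation and acyclicity make the support of x a family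
-- of node-disjoint 0–n̄ paths, each of which traverses an arc of Ǎ (else it would violate its
-- infeasible-path cut). Assign to every i ∈ T with z_i = 1 an Ǎ-arc on the path through i:
-- it lies before i, hence in Ǎ⁻_T, or after i, hence in Ǎ⁺_T. Two nodes assigned the same
-- arc lie on a common path, so they coincide because T is conflicting; the assignment is
-- injective, and the right-hand side counts every assigned arc at least once.

open import Defs
open import Data.Nat using (ℕ)
open import Data.Fin using (Fin)
open import Data.Fin.Subset using (Subset)
open import Data.Bool using (Bool; true)
open import Data.Rational using (ℚ; _≤_; _+_)
open import Relation.Nullary using (Dec)
open import Relation.Binary.PropositionalEquality using (_≡_)

import Data.Nat as ℕ
import Data.Nat.Properties as ℕ
import Data.Fin as Fin
import Data.Rational as ℚ
import Data.Rational.Properties as ℚ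
open import Algebra.Bundles using (CommutativeMonoid)
import Algebra.Properties.CommutativeSemigroup as CommutativeSemigroupProperties
open import Data.Bool using (false; if_then_else_; _∧_)
open import Data.Empty using (⊥-elim)
open import Data.Fin.Induction using (spo-wellFounded; spo-noetherian)
open import Data.Fin.Subset using () renaming (_∈_ to _∈ˢ_)
open import Data.Fin.Subset.Properties using (_∈?_)
open import Data.List using (List; []; _∷_; _++_; map; foldr; cartesianProduct; allFin; length)
open import Data.List.Membership.Propositional using (_∈_)
open import Data.List.Membership.Propositional.Properties
  using (∈-++⁺ˡ; ∈-++⁺ʳ; ∈-map⁺; ∈-allFin; ∈-cartesianProduct⁺)
open import Data.List.Relation.Unary.All as All using (All; []; _∷_)
open import Data.List.Relation.Unary.AllPairs using ([]; _∷_)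
open import Data.List.Relation.Unary.Any using (here; there)
open import Data.List.Relation.Unary.Unique.Propositional using (Unique)
open import Data.List.Relation.Unary.Unique.Propositional.Properties using (allFin⁺)
open import Data.Product using (Σ; ∃; _×_; _,_; proj₁; proj₂)
open import Data.Product.Properties using () renaming (≡-dec to ×-≡-dec)
open import Data.Rational using (0ℚ; 1ℚ)
open import Data.Sum using (_⊎_; inj₁; inj₂)
open import Function using (flip; id; _∘_)
open import Induction.WellFounded using (WellFounded; Acc; acc; module Subrelation)
open import Relation.Binary.Core using (Rel)
open import Relation.Binary.Definitions using (DecidableEquality)
open import Relation.Binary.Structures using (IsStrictPartialOrder)
open import Relation.Binary.Construct.Closure.Transitive as Plus using (TransClosure; [_])
open import Relation.Binary.Construct.Closure.ReflexiveTransitive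
  using (Star; ε; _◅_; _◅◅_; gmap; reverse)
open import Relation.Binary.PropositionalEquality
  using ( _≢_; refl; sym; trans; cong; cong₂; subst; subst₂; resp₂; isEquivalence
        ; module ≡-Reasoning)
open import Relation.Nullary using (¬_; yes; no; does)
open import Relation.Nullary.Decidable using (dec-true)

module ListSum {c ℓ} (M : CommutativeMonoid c ℓ) where

  open CommutativeMonoid M
    using (Carrier; _≈_; _∙_; ∙-cong; ∙-congˡ; identityˡ; assoc; commutativeSemigroup)
    renaming (ε to 0#; refl to ≈-refl; sym to ≈-sym; trans to ≈-trans)
  open CommutativeSemigroupProperties commutativeSemigroup using (interchange)

  sum : {X : Set} → List X → (X → Carrier) → Carrier
  sum xs f = foldr (λ x acc → f x ∙ acc) 0# xs

  module _ {X : Set} where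

    sum-cong : ∀ (xs : List X) {f g : X → Carrier} → (∀ a → f a ≈ g a) → sum xs f ≈ sum xs g
    sum-cong []       f≈g = ≈-refl
    sum-cong (x ∷ xs) f≈g = ∙-cong (f≈g x) (sum-cong xs f≈g)

    sum-0# : ∀ (xs : List X) → sum xs (λ _ → 0#) ≈ 0#
    sum-0# []       = ≈-refl
    sum-0# (x ∷ xs) = ≈-trans (identityˡ _) (sum-0# xs)

    sum-distrib : ∀ (xs : List X) (f g : X → Carrier) →
                  sum xs (λ a → f a ∙ g a) ≈ sum xs f ∙ sum xs g
    sum-distrib []       f g = ≈-sym (identityˡ 0#)
    sum-distrib (x ∷ xs) f g = ≈-trans (∙-congˡ (sum-distrib xs f g)) (interchange (f x) (g x) _ _)

    sum-swap : ∀ {Y : Set} (xs : List X) (ys : List Y) (F : X → Y → Carrier) →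
               sum xs (λ a → sum ys (F a)) ≈ sum ys (λ b → sum xs (λ a → F a b))
    sum-swap xs []       F = sum-0# xs
    sum-swap xs (y ∷ ys) F = ≈-trans (sum-distrib xs (λ a → F a y) _) (∙-congˡ (sum-swap xs ys F))

    sum-++ : ∀ (xs ys : List X) (f : X → Carrier) → sum (xs ++ ys) f ≈ sum xs f ∙ sum ys f
    sum-++ []       ys f = ≈-sym (identityˡ _)
    sum-++ (x ∷ xs) ys f = ≈-trans (∙-congˡ (sum-++ xs ys f)) (≈-sym (assoc _ _ _))

    sum-map : ∀ {Y : Set} (g : Y → X) (ys : List Y) (f : X → Carrier) →
              sum (map g ys) f ≈ sum ys (λ b → f (g b))
    sum-map g []       f = ≈-refl
    sum-map g (y ∷ ys) f = ∙-congˡ (sum-map g ys f)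

  sum-cartesianProduct : ∀ {X Y : Set} (xs : List X) (ys : List Y) (f : X × Y → Carrier) →
    sum (cartesianProduct xs ys) f ≈ sum xs (λ a → sum ys (λ b → f (a , b)))
  sum-cartesianProduct []       ys f = ≈-refl
  sum-cartesianProduct (x ∷ xs) ys f =
    ≈-trans (sum-++ (map (x ,_) ys) _ f)
            (∙-cong (sum-map (x ,_) ys f) (sum-cartesianProduct xs ys f))

module Σℕ = ListSum ℕ.+-0-commutativeMonoid
module Σℚ = ListSum ℚ.+-0-commutativeMonoid

module _ {X : Set} where

  sumℕ-mono : ∀ (xs : List X) {f g : X → ℕ} → (∀ a → f a ℕ.≤ g a) → sumℕ xs f ℕ.≤ sumℕ xs g
  sumℕ-mono []       f≤g = ℕ.z≤n
  sumℕ-mono (x ∷ xs) f≤g = ℕ.+-mono-≤ (f≤g x) (sumℕ-mono xs f≤g)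

  ≤-sumℕ : ∀ {xs : List X} {u} (f : X → ℕ) → u ∈ xs → f u ℕ.≤ sumℕ xs f
  ≤-sumℕ f (here refl)            = ℕ.m≤m+n _ _
  ≤-sumℕ {x ∷ _} f (there u∈xs) = ℕ.≤-trans (≤-sumℕ f u∈xs) (ℕ.m≤n+m _ (f x))

  +-≤-sumℕ : ∀ {xs : List X} {u u′} (f : X → ℕ) → u ∈ xs → u′ ∈ xs → u ≢ u′ →
             f u ℕ.+ f u′ ℕ.≤ sumℕ xs f
  +-≤-sumℕ f (here refl) (here refl)  u≢u′ = ⊥-elim (u≢u′ refl)
  +-≤-sumℕ f (here refl) (there u′∈xs) _    = ℕ.+-monoʳ-≤ (f _) (≤-sumℕ f u′∈xs)
  +-≤-sumℕ {x ∷ xs} {u} f (there u∈xs) (here refl) _ =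
    subst (ℕ._≤ f x ℕ.+ sumℕ xs f) (ℕ.+-comm (f x) (f u)) (ℕ.+-monoʳ-≤ (f x) (≤-sumℕ f u∈xs))
  +-≤-sumℕ {x ∷ _} f (there u∈xs) (there u′∈xs) u≢u′ =
    ℕ.≤-trans (+-≤-sumℕ f u∈xs u′∈xs u≢u′) (ℕ.m≤n+m _ (f x))

  sumℕ-nonzero : ∀ (xs : List X) (f : X → ℕ) → sumℕ xs f ≢ 0 → ∃ λ u → u ∈ xs × f u ≢ 0
  sumℕ-nonzero []       f Σ≢0 = ⊥-elim (Σ≢0 refl)
  sumℕ-nonzero (x ∷ xs) f Σ≢0 with f x ℕ.≟ 0
  ... | no fx≢0 = x , here refl , fx≢0
  ... | yes fx≡0 with sumℕ-nonzero xs f (λ Σ≡0 → Σ≢0 (cong₂ ℕ._+_ fx≡0 Σ≡0))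
  ...   | u , u∈xs , fu≢0 = u , there u∈xs , fu≢0

  sumℕ-≤-singleSupport : ∀ (xs : List X) (f : X → ℕ) {B : ℕ} → Unique xs → (∀ a → f a ℕ.≤ B) →
                  (∀ a b → f a ≢ 0 → f b ≢ 0 → a ≡ b) → sumℕ xs f ℕ.≤ B
  sumℕ-≤-singleSupport []       f u!       f≤B single = ℕ.z≤n
  sumℕ-≤-singleSupport (x ∷ xs) f (x∉ ∷ u!) f≤B single with f x ℕ.≟ 0 | sumℕ xs f ℕ.≟ 0
  ... | yes fx≡0 | _ rewrite fx≡0 = sumℕ-≤-singleSupport xs f u! f≤B single
  ... | no _     | yes Σ≡0 rewrite Σ≡0 = subst (ℕ._≤ _) (sym (ℕ.+-identityʳ (f x))) (f≤B x)
  ... | no fx≢0  | no Σ≢0 with sumℕ-nonzero xs f Σ≢0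
  ...   | u , u∈xs , fu≢0 = ⊥-elim (All.lookup x∉ u∈xs (single x u fx≢0 fu≢0))

module _ {I J : Set} (_≟_ : DecidableEquality J) (g : I → ℕ) (h : J → ℕ)
         (σ : ∀ i → g i ≢ 0 → J) where

  private
    hit : (i : I) → Dec (g i ≡ 0) → J → ℕ
    hit i (yes _)   j = 0
    hit i (no g≢0) j = if does (σ i g≢0 ≟ j) then g i else 0

    g≤Σhit : ∀ {js} → (∀ i g≢0 → σ i g≢0 ∈ js) → ∀ i d → g i ℕ.≤ sumℕ js (hit i d)
    g≤Σhit σ∈js i (yes g≡0) = ℕ.≤-trans (ℕ.≤-reflexive g≡0) ℕ.z≤n
    g≤Σhit σ∈js i (no g≢0) =
      ℕ.≤-trans (ℕ.≤-reflexive (cong (if_then g i else 0) (sym σi≟σi)))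
                (≤-sumℕ (hit i (no g≢0)) (σ∈js i g≢0))
      where σi≟σi = dec-true (σ i g≢0 ≟ σ i g≢0) refl

    hit≤h : (∀ i g≢0 → g i ℕ.≤ h (σ i g≢0)) → ∀ i d j → hit i d j ℕ.≤ h j
    hit≤h g≤h i (yes _) j = ℕ.z≤n
    hit≤h g≤h i (no g≢0) j with σ i g≢0 ≟ j
    ... | yes refl = g≤h i g≢0
    ... | no _     = ℕ.z≤n

    hit-nonzero : ∀ i d j → hit i d j ≢ 0 → Σ (g i ≢ 0) λ g≢0 → σ i g≢0 ≡ j
    hit-nonzero i (yes _)   j hit≢0 = ⊥-elim (hit≢0 refl)
    hit-nonzero i (no g≢0) j hit≢0 with σ i g≢0 ≟ j
    ... | yes σi≡j = g≢0 , σi≡j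
    ... | no _     = ⊥-elim (hit≢0 refl)

  sumℕ-≤-injection : ∀ (is : List I) (js : List J) → Unique is →
    (∀ i g≢0 → σ i g≢0 ∈ js) →
    (∀ i g≢0 → g i ℕ.≤ h (σ i g≢0)) →
    (∀ i i′ g≢0 g′≢0 → σ i g≢0 ≡ σ i′ g′≢0 → i ≡ i′) →
    sumℕ is g ℕ.≤ sumℕ js h
  sumℕ-≤-injection is js is! σ∈js g≤h σ-injective = begin
    sumℕ is g                                 ≤⟨ sumℕ-mono is (λ i → g≤Σhit σ∈js i (g i ℕ.≟ 0)) ⟩
    sumℕ is (λ i → sumℕ js (hit′ i))          ≡⟨ Σℕ.sum-swap is js hit′ ⟩
    sumℕ js (λ j → sumℕ is (λ i → hit′ i j))  ≤⟨ sumℕ-mono js Σhit≤h ⟩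
    sumℕ js h                                 ∎
    where
      open ℕ.≤-Reasoning
      hit′ : I → J → ℕ
      hit′ i = hit i (g i ℕ.≟ 0)
      Σhit≤h : ∀ j → sumℕ is (λ i → hit′ i j) ℕ.≤ h j
      Σhit≤h j = sumℕ-≤-singleSupport is (λ i → hit′ i j) is!
        (λ i → hit≤h g≤h i (g i ℕ.≟ 0) j)
        (λ i i′ hit≢0 hit′≢0 →
          let (g≢0 , σi≡j) = hit-nonzero i (g i ℕ.≟ 0) j hit≢0
              (g′≢0 , σi′≡j) = hit-nonzero i′ (g i′ ℕ.≟ 0) j hit′≢0
          in σ-injective i i′ g≢0 g′≢0 (trans σi≡j (sym σi′≡j)))

module _ {X : Set} where

  sumℚ-mono : ∀ (xs : List X) {f g : X → ℚ} → All (λ a → f a ≤ g a) xs → sumℚ xs f ≤ sumℚ xs g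
  sumℚ-mono []       []            = ℚ.≤-refl
  sumℚ-mono (x ∷ xs) (fx≤gx ∷ f≤g) = ℚ.+-mono-≤ fx≤gx (sumℚ-mono xs f≤g)

  *-sumℚ : ∀ (c : ℚ) (xs : List X) (f : X → ℚ) → c ℚ.* sumℚ xs f ≡ sumℚ xs (λ a → c ℚ.* f a)
  *-sumℚ c []       f = ℚ.*-zeroʳ c
  *-sumℚ c (x ∷ xs) f = trans (ℚ.*-distribˡ-+ c (f x) _) (cong (c ℚ.* f x +_) (*-sumℚ c xs f))

toℚ : ℕ → ℚ
toℚ ℕ.zero    = 0ℚ
toℚ (ℕ.suc m) = 1ℚ + toℚ m

toℚ-+ : ∀ m k → toℚ (m ℕ.+ k) ≡ toℚ m + toℚ k
toℚ-+ ℕ.zero    k = sym (ℚ.+-identityˡ (toℚ k))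
toℚ-+ (ℕ.suc m) k = trans (cong (1ℚ +_) (toℚ-+ m k)) (sym (ℚ.+-assoc 1ℚ (toℚ m) (toℚ k)))

toℚ-nonNegative : ∀ m → 0ℚ ≤ toℚ m
toℚ-nonNegative ℕ.zero    = ℚ.≤-refl
toℚ-nonNegative (ℕ.suc m) = ℚ.+-mono-≤ (ℚ.nonNegative⁻¹ 1ℚ) (toℚ-nonNegative m)

toℚ-mono : ∀ {m k} → m ℕ.≤ k → toℚ m ≤ toℚ k
toℚ-mono {k = k} ℕ.z≤n = toℚ-nonNegative k
toℚ-mono (ℕ.s≤s m≤k)   = ℚ.+-monoʳ-≤ 1ℚ (toℚ-mono m≤k)

toℚ-sumℕ : ∀ {X : Set} (xs : List X) (f : X → ℕ) → toℚ (sumℕ xs f) ≡ sumℚ xs (λ a → toℚ (f a))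
toℚ-sumℕ []       f = refl
toℚ-sumℕ (x ∷ xs) f = trans (toℚ-+ (f x) (sumℕ xs f)) (cong (toℚ (f x) +_) (toℚ-sumℕ xs f))

toℚ-b2n : ∀ b → toℚ (b2n b) ≡ b2q b
toℚ-b2n true  = ℚ.+-identityʳ 1ℚ
toℚ-b2n false = refl

toℚ-if : ∀ b m → toℚ (if b then m else 0) ≡ (if b then toℚ m else 0ℚ)
toℚ-if true  m = refl
toℚ-if false m = refl

module _ {B : Set} where

  combination : List (ℚ × B) → (B → ℚ) → ℚ
  combination L φ = sumℚ L (λ (l , b) → l ℚ.* φ b)

  combination-zero : ∀ (L : List (ℚ × B)) → combination L (λ _ → 0ℚ) ≡ 0ℚ
  combination-zero L = trans (Σℚ.sum-cong L (λ (l , _) → ℚ.*-zeroʳ l)) (Σℚ.sum-0# L)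

  combination-distrib : ∀ (L : List (ℚ × B)) (φ ψ : B → ℚ) →
    combination L (λ b → φ b + ψ b) ≡ combination L φ + combination L ψ
  combination-distrib L φ ψ =
    trans (Σℚ.sum-cong L (λ (l , b) → ℚ.*-distribˡ-+ l (φ b) (ψ b)))
          (Σℚ.sum-distrib L (λ (l , b) → l ℚ.* φ b) (λ (l , b) → l ℚ.* ψ b))

  combination-mono : ∀ {P : B → Set} (L : List (ℚ × B)) {φ ψ : B → ℚ} →
    All (λ (l , b) → 0ℚ ≤ l × P b) L → (∀ b → P b → φ b ≤ ψ b) →
    combination L φ ≤ combination L ψ
  combination-mono L weights φ≤ψ = sumℚ-mono L (All.map
    (λ { {l , b} (0≤l , Pb) → ℚ.*-monoˡ-≤-nonNeg l {{ℚ.nonNegative 0≤l}} (φ≤ψ b Pb) }) weights)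

  sumℚ-combination : ∀ {X : Set} (L : List (ℚ × B)) (xs : List X) {Y : X → ℚ} (φ : X → B → ℚ) →
    (∀ a → Y a ≡ combination L (φ a)) →
    sumℚ xs Y ≡ combination L (λ b → sumℚ xs (λ a → φ a b))
  sumℚ-combination L xs {Y} φ Y≡ = begin
    sumℚ xs Y
      ≡⟨ Σℚ.sum-cong xs Y≡ ⟩
    sumℚ xs (λ a → sumℚ L (λ (l , b) → l ℚ.* φ a b))
      ≡⟨ Σℚ.sum-swap xs L (λ a (l , b) → l ℚ.* φ a b) ⟩
    sumℚ L (λ (l , b) → sumℚ xs (λ a → l ℚ.* φ a b))
      ≡⟨ Σℚ.sum-cong L (λ (l , b) → sym (*-sumℚ l xs (λ a → φ a b))) ⟩
    combination L (λ b → sumℚ xs (λ a → φ a b))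
      ∎
    where open ≡-Reasoning

  if-combination : ∀ (L : List (ℚ × B)) c {Y : ℚ} (φ : B → ℚ) →
    (c ≡ true → Y ≡ combination L φ) →
    (if c then Y else 0ℚ) ≡ combination L (λ b → if c then φ b else 0ℚ)
  if-combination L true  φ Y≡ = Y≡ refl
  if-combination L false φ Y≡ = sym (combination-zero L)

module _ {n ℓ} {R : Rel (Fin n) ℓ} (acyclic : ∀ i → ¬ TransClosure R i i) where

  private
    R⁺-isStrictPartialOrder : IsStrictPartialOrder _≡_ (TransClosure R)
    R⁺-isStrictPartialOrder = record
      { isEquivalence = isEquivalence
      ; irrefl        = λ { refl → acyclic _ }
      ; trans         = Plus.transitive R
      ; <-resp-≈      = resp₂ (TransClosure R)
      }

  acyclic⇒wellFounded : WellFounded R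
  acyclic⇒wellFounded = Subrelation.wellFounded [_] (spo-wellFounded R⁺-isStrictPartialOrder)

  acyclic⇒noetherian : WellFounded (flip R)
  acyclic⇒noetherian = Subrelation.wellFounded [_] (spo-noetherian R⁺-isStrictPartialOrder)

functional⇒Star-comparable : ∀ {a ℓ} {X : Set a} {R : Rel X ℓ} →
  (∀ {c w w′} → R c w → R c w′ → w ≡ w′) →
  ∀ {v i j} → Star R v i → Star R v j → Star R i j ⊎ Star R j i
functional⇒Star-comparable functional ε       v→*j = inj₁ v→*j
functional⇒Star-comparable functional (r ◅ p) ε    = inj₂ (r ◅ p)
functional⇒Star-comparable functional (r ◅ p) (r′ ◅ q) with functional r r′
... | refl = functional⇒Star-comparable functional p q

b2q-∧ : ∀ a b → b2q (a ∧ b) ≡ (if a then b2q b else 0ℚ)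
b2q-∧ true  b = refl
b2q-∧ false b = refl

∧-trueˡ : ∀ {a b} → a ∧ b ≡ true → a ≡ true
∧-trueˡ {true} _ = refl

embed : ∀ {n} → (Node n → Node n → Bool) → Node n → Node n → ℚ
embed x u v = b2q (x u v)

module _ {n : ℕ} (A Ac : Fin n → Fin n → Bool) where

  Represents : (Node n → Node n → ℚ) → List (ℚ × (Node n → Node n → Bool)) → Set
  Represents y L = ∀ u v → isArc A u v ≡ true → y u v ≡ combination L (λ x → embed x u v)

  ArcLinear : ((Node n → Node n → ℚ) → ℚ) → Set
  ArcLinear F = ∀ y L → Represents y L → F y ≡ combination L (λ x → F (embed x))

  zSum-arcLinear : ∀ T → ArcLinear (zSum A T)
  zSum-arcLinear T y L y≡ =
    sumℚ-combination L (allFin n) _ λ i → if-combination L (does (i ∈? T)) _ λ _ →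
      sumℚ-combination L nodes _ λ u → if-combination L (isArc A u (inner i)) _ λ u→i →
        y≡ u (inner i) u→i

  sumCheckWhere-arcLinear : (∀ u v → Ac u v ≡ true → A u v ≡ true) →
    ∀ {P : Fin n → Fin n → Set} (d : ∀ u v → Dec (P u v)) → ArcLinear (sumCheckWhere A Ac d)
  sumCheckWhere-arcLinear Ac⊆A d y L y≡ =
    sumℚ-combination L (allFin n) _ λ u → sumℚ-combination L (allFin n) _ λ v →
      if-combination L (Ac u v ∧ does (d u v)) _ λ checked →
        y≡ (inner u) (inner v) (Ac⊆A u v (∧-trueˡ checked))

  -- The inequality is homogeneous.
  valid-on-hull : ∀ {F G H} → ArcLinear F → ArcLinear G → ArcLinear H →
    (∀ x → FeasibleBinary A Ac x → F (embed x) ≤ G (embed x) + H (embed x)) →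
    ∀ y → InP A Ac y → F y ≤ G y + H y
  valid-on-hull {F} {G} {H} F-linear G-linear H-linear binary-valid y (L , weights , _ , y≡) = begin
    F y
      ≡⟨ F-linear y L y≡ ⟩
    combination L (λ x → F (embed x))
      ≤⟨ combination-mono L weights binary-valid ⟩
    combination L (λ x → G (embed x) + H (embed x))
      ≡⟨ combination-distrib L _ _ ⟩
    combination L (λ x → G (embed x)) + combination L (λ x → H (embed x))
      ≡⟨ cong₂ _+_ (G-linear y L y≡) (H-linear y L y≡) ⟨
    G y + H y
      ∎
    where open ℚ.≤-Reasoning

inner-injective : ∀ {n} {i j : Fin n} → inner i ≡ inner j → i ≡ j
inner-injective refl = refl

∈-nodes : ∀ {n} (u : Node n) → u ∈ nodes
∈-nodes src               = here refl
∈-nodes {n} (inner i)     = there (∈-++⁺ˡ (∈-map⁺ inner (∈-allFin i)))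
∈-nodes {n} snk           = there (∈-++⁺ʳ (map inner (allFin n)) (here refl))

b2n-∧-nonzero : ∀ {a b} → b2n (a ∧ b) ≢ 0 → a ≡ true × b ≡ true
b2n-∧-nonzero {true}  {true}  _    = refl , refl
b2n-∧-nonzero {true}  {false} ≢0 = ⊥-elim (≢0 refl)
b2n-∧-nonzero {false}         ≢0 = ⊥-elim (≢0 refl)

module FlowPaths {n : ℕ} (A Ac : Fin n → Fin n → Bool) (acyclic : Acyclic A)
                 (x : Node n → Node n → Bool) (feasible : FeasibleBinary A Ac x) where

  Flow : Fin n → Fin n → Set
  Flow j k = A j k ≡ true × x (inner j) (inner k) ≡ true

  inF : Fin n → ℕ
  inF = inFlow A Ac x

  private
    inTerm outTerm : Fin n → Node n → ℕ
    inTerm  c u = b2n (isArc A u (inner c) ∧ x u (inner c))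
    outTerm c v = b2n (isArc A (inner c) v ∧ x (inner c) v)

    in≤1 : ∀ c → inF c ℕ.≤ 1
    in≤1 = proj₁ feasible

    out≤1 : ∀ c → outFlow A Ac x c ℕ.≤ 1
    out≤1 c = subst (ℕ._≤ 1) (proj₁ (proj₂ feasible) c) (in≤1 c)

    flow-term : ∀ {j k} → Flow j k → b2n (A j k ∧ x (inner j) (inner k)) ≡ 1
    flow-term (Ajk , xjk) = cong₂ (λ a b → b2n (a ∧ b)) Ajk xjk

    unique-inner-term : (f : Node n → ℕ) → sumℕ nodes f ℕ.≤ 1 →
                        ∀ {j j′} → f (inner j) ≡ 1 → f (inner j′) ≡ 1 → j ≡ j′
    unique-inner-term f Σ≤1 {j} {j′} fj≡1 fj′≡1 with j Fin.≟ j′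
    ... | yes j≡j′ = j≡j′
    ... | no j≢j′  = ⊥-elim (ℕ.<-irrefl refl (ℕ.≤-trans (begin
      2                            ≡⟨ cong₂ ℕ._+_ fj≡1 fj′≡1 ⟨
      f (inner j) ℕ.+ f (inner j′) ≤⟨ +-≤-sumℕ f (∈-nodes _) (∈-nodes _) (j≢j′ ∘ inner-injective) ⟩
      sumℕ nodes f                 ∎) Σ≤1))
      where open ℕ.≤-Reasoning

    nonzero-inner-term : (f : Node n → ℕ) {j : Fin n} → f (inner j) ≡ 1 → sumℕ nodes f ≢ 0
    nonzero-inner-term f fj≡1 Σ≡0 =
      ℕ.<⇒≢ (ℕ.≤-trans (ℕ.≤-reflexive (sym fj≡1)) (≤-sumℕ f (∈-nodes _))) (sym Σ≡0)

  predecessor-unique : ∀ {p p′ c} → Flow p c → Flow p′ c → p ≡ p′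
  predecessor-unique {c = c} f f′ =
    unique-inner-term (inTerm c) (in≤1 c) (flow-term f) (flow-term f′)

  successor-unique : ∀ {c w w′} → Flow c w → Flow c w′ → w ≡ w′
  successor-unique {c} f f′ =
    unique-inner-term (outTerm c) (out≤1 c) (flow-term f) (flow-term f′)

  flow-into : ∀ {p c} → Flow p c → inF c ≢ 0
  flow-into {c = c} f = nonzero-inner-term (inTerm c) (flow-term f)

  flow-out-of : ∀ {c w} → Flow c w → inF c ≢ 0
  flow-out-of {c} f in≡0 =
    nonzero-inner-term (outTerm c) (flow-term f) (trans (sym (proj₁ (proj₂ feasible) c)) in≡0)

  source-or-predecessor : ∀ c → inF c ≢ 0 → x src (inner c) ≡ true ⊎ ∃ λ p → Flow p c
  source-or-predecessor c in≢0 with sumℕ-nonzero nodes (inTerm c) in≢0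
  ... | src     , _ , t≢0 = inj₁ (proj₂ (b2n-∧-nonzero t≢0))
  ... | inner p , _ , t≢0 = inj₂ (p , b2n-∧-nonzero t≢0)
  ... | snk     , _ , t≢0 = ⊥-elim (t≢0 refl)

  sink-or-successor : ∀ c → inF c ≢ 0 → x (inner c) snk ≡ true ⊎ ∃ λ w → Flow c w
  sink-or-successor c in≢0
    with sumℕ-nonzero nodes (outTerm c) (subst (_≢ 0) (proj₁ (proj₂ feasible) c) in≢0)
  ... | src     , _ , t≢0 = ⊥-elim (t≢0 refl)
  ... | inner w , _ , t≢0 = inj₂ (w , b2n-∧-nonzero t≢0)
  ... | snk     , _ , t≢0 = inj₁ (proj₂ (b2n-∧-nonzero t≢0))

  private
    Arc : Fin n → Fin n → Set
    Arc j k = A j k ≡ true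

  back-to-source : ∀ {c} → Acc Arc c → inF c ≢ 0 →
                   ∃ λ a → x src (inner a) ≡ true × Star Flow a c
  back-to-source {c} (acc rec) in≢0 with source-or-predecessor c in≢0
  ... | inj₁ src→c       = c , src→c , ε
  ... | inj₂ (p , p→c) with back-to-source (rec (proj₁ p→c)) (flow-out-of p→c)
  ...   | a , src→a , a→p = a , src→a , a→p ◅◅ p→c ◅ ε

  forward-to-sink : ∀ {c} → Acc (flip Arc) c → inF c ≢ 0 →
                    ∃ λ b → Star Flow c b × x (inner b) snk ≡ true
  forward-to-sink {c} (acc rec) in≢0 with sink-or-successor c in≢0
  ... | inj₁ c→snk     = c , ε , c→snk
  ... | inj₂ (w , c→w) with forward-to-sink (rec (proj₁ c→w)) (flow-into c→w)
  ...   | b , w→b , b→snk = b , c→w ◅ w→b , b→snk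

  record FlowPathThrough (i : Fin n) : Set where
    constructor flowPath
    field
      {first last} : Fin n
      starts       : x src (inner first) ≡ true
      before       : Star Flow first i
      after        : Star Flow i last
      ends         : x (inner last) snk ≡ true

  flowPathThrough : ∀ i → inF i ≢ 0 → FlowPathThrough i
  flowPathThrough i in≢0
    with back-to-source (acyclic⇒wellFounded acyclic i) in≢0
       | forward-to-sink (acyclic⇒noetherian acyclic i) in≢0
  ... | _ , src→a , a→i | _ , i→b , b→snk = flowPath src→a a→i i→b b→snk

  flow-reach : ∀ {a b} → Star Flow a b → Reach A (inner a) (inner b)
  flow-reach = gmap inner proj₁

  vertices interior : ∀ {a b} → Star Flow a b → List (Fin n)
  vertices {a} p  = a ∷ interior p
  interior ε       = []
  interior (_ ◅ p) = vertices p

  route : ∀ {a b} → Star Flow a b → List (Node n)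
  route p = map inner (vertices p) ++ snk ∷ []

  route-chain : ∀ {a b} (p : Star Flow a b) → Chain A (route p)
  route-chain ε              = refl , _
  route-chain ((Aaw , _) ◅ p) = Aaw , route-chain p

  vertices-STPath : ∀ {a b} (p : Star Flow a b) → STPath A (vertices p)
  vertices-STPath p = refl , route-chain p

  ∈-vertices-◅◅ : ∀ {a b c k} (p : Star Flow a b) (q : Star Flow b c) →
                  k ∈ vertices q → k ∈ vertices (p ◅◅ q)
  ∈-vertices-◅◅ ε       q k∈q = k∈q
  ∈-vertices-◅◅ (_ ◅ p) q k∈q = there (∈-vertices-◅◅ p q k∈q)

  route-weight : ∀ {a b} (p : Star Flow a b) → x (inner b) snk ≡ true →
                 pathSum A Ac x (route p) ≡ length (vertices p)
  route-weight ε               b→snk rewrite b→snk = refl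
  route-weight ((_ , xaw) ◅ p) b→snk rewrite xaw   = cong ℕ.suc (route-weight p b→snk)

  -- A flow path carries one unit on each of its length + 1 arcs, so it must be feasible.
  flowPath-hasCheck : ∀ {a b} (p : Star Flow a b) → x src (inner a) ≡ true →
                      x (inner b) snk ≡ true → ¬ NoCheck A Ac (route p)
  flowPath-hasCheck p src→a b→snk noCheck
    with proj₂ (proj₂ feasible) (vertices p) (vertices-STPath p) (refl , noCheck)
  ... | weight≤length rewrite src→a | route-weight p b→snk = ℕ.<-irrefl refl weight≤length

  record CheckArc (P : Fin n → Fin n → Set) : Set where
    constructor checkArc
    field
      {u v}   : Fin n
      checked : Ac u v ≡ true
      flows   : Flow u v
      holds   : P u v

  Around : Fin n → Fin n → Fin n → Set
  Around i u v = Star Flow v i ⊎ Star Flow i u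

  checkArc-after : ∀ {i b} (q : Star Flow i b) → ¬ NoCheck A Ac (route q) →
                   CheckArc (λ u _ → Star Flow i u)
  checkArc-after ε hasCheck = ⊥-elim (hasCheck (refl , _))
  checkArc-after {i} (_◅_ {j = w} i→w q) hasCheck with Ac i w in Aciw
  ... | true  = checkArc Aciw i→w ε
  ... | false with checkArc-after q (λ noCheck → hasCheck (refl , noCheck))
  ...   | checkArc Acuv u→v w→u = checkArc Acuv u→v (i→w ◅ w→u)

  checkArc-around : ∀ {a i b} (p : Star Flow a i) (q : Star Flow i b) →
                    ¬ NoCheck A Ac (route (p ◅◅ q)) → CheckArc (Around i)
  checkArc-around ε q hasCheck with checkArc-after q hasCheck
  ... | checkArc Acuv u→v i→u = checkArc Acuv u→v (inj₂ i→u)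
  checkArc-around {a} (_◅_ {j = w} a→w p) q hasCheck with Ac a w in Acaw
  ... | true  = checkArc Acaw a→w (inj₁ p)
  ... | false = checkArc-around p q (λ noCheck → hasCheck (refl , noCheck))

  aligned : ∀ {u v i j} → Flow u v → Around i u v → Around j u v →
            Star Flow i j ⊎ Star Flow j i
  aligned u→v (inj₁ v→i) (inj₁ v→j) = functional⇒Star-comparable successor-unique v→i v→j
  aligned u→v (inj₁ v→i) (inj₂ j→u) = inj₂ (j→u ◅◅ u→v ◅ v→i)
  aligned u→v (inj₂ i→u) (inj₁ v→j) = inj₁ (i→u ◅◅ u→v ◅ v→j)
  aligned u→v (inj₂ i→u) (inj₂ j→u)
    with functional⇒Star-comparable predecessor-unique (reverse id i→u) (reverse id j→u)
  ... | inj₁ j←i = inj₂ (reverse id j←i)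
  ... | inj₂ i←j = inj₁ (reverse id i←j)

  OnCommonPath : Fin n → Fin n → Set
  OnCommonPath i j = Σ (List (Fin n)) λ vs → STPath A vs × i ∈ vs × j ∈ vs

  onCommonPath : ∀ {i j} → FlowPathThrough i → FlowPathThrough j → Star Flow i j → OnCommonPath i j
  onCommonPath (flowPath _ a→i _ _) (flowPath _ _ j→b _) i→j =
    vertices path , vertices-STPath path ,
    ∈-vertices-◅◅ a→i (i→j ◅◅ j→b) (here refl) ,
    ∈-vertices-◅◅ a→i (i→j ◅◅ j→b) (∈-vertices-◅◅ i→j j→b (here refl))
    where path = a→i ◅◅ i→j ◅◅ j→b

  module _ (T : Subset n) (conflicting : Conflicting A T) where

    chosenArc : ∀ i → inF i ≢ 0 → CheckArc (Around i)
    chosenArc i in≢0 with flowPathThrough i in≢0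
    ... | flowPath src→a a→i i→b b→snk =
      checkArc-around a→i i→b (flowPath-hasCheck (a→i ◅◅ i→b) src→a b→snk)

    arcOf : ∀ {P} → CheckArc P → Fin n × Fin n
    arcOf c = CheckArc.u c , CheckArc.v c

    chosenArc-injective : ∀ {i j} (i∈T : i ∈ˢ T) (j∈T : j ∈ˢ T) in≢0 jn≢0 →
      arcOf (chosenArc i in≢0) ≡ arcOf (chosenArc j jn≢0) → i ≡ j
    chosenArc-injective {i} {j} i∈T j∈T in≢0 jn≢0 same with i Fin.≟ j
    ... | yes i≡j = i≡j
    ... | no i≢j  = ⊥-elim (conflicting i j i∈T j∈T i≢j (common (aligned u→v i-around j-around)))
      where
        u→v = CheckArc.flows (chosenArc i in≢0)
        i-around = CheckArc.holds (chosenArc i in≢0)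
        j-around = subst (λ (u , v) → Around j u v) (sym same) (CheckArc.holds (chosenArc j jn≢0))
        through-i = flowPathThrough i in≢0
        through-j = flowPathThrough j jn≢0
        common : Star Flow i j ⊎ Star Flow j i → OnCommonPath i j
        common (inj₁ i→j) = onCommonPath through-i through-j i→j
        common (inj₂ j→i) =
          let (vs , path , j∈vs , i∈vs) = onCommonPath through-j through-i j→i
          in  vs , path , i∈vs , j∈vs

    weight : Fin n → ℕ
    weight i = if does (i ∈? T) then inF i else 0

    private
      weight-nonzero : ∀ i → weight i ≢ 0 → i ∈ˢ T × inF i ≢ 0
      weight-nonzero i w≢0 with i ∈? T
      ... | yes i∈T = i∈T , w≢0
      ... | no _    = ⊥-elim (w≢0 refl)

      weight≤1 : ∀ i → weight i ℕ.≤ 1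
      weight≤1 i with i ∈? T
      ... | yes _ = in≤1 i
      ... | no _  = ℕ.z≤n

      assigned : ∀ i → weight i ≢ 0 → Fin n × Fin n
      assigned i w≢0 = arcOf (chosenArc i (proj₂ (weight-nonzero i w≢0)))

    checkCount : ∀ {P : Fin n → Fin n → Set} → (∀ u v → Dec (P u v)) → Fin n → Fin n → ℕ
    checkCount d u v = if Ac u v ∧ does (d u v) then b2n (x (inner u) (inner v)) else 0

    countWhere : ∀ {P : Fin n → Fin n → Set} → (∀ u v → Dec (P u v)) → ℕ
    countWhere d = sumℕ (allFin n) λ u → sumℕ (allFin n) λ v → checkCount d u v

    checkCount-flow : ∀ {P : Fin n → Fin n → Set} (d : ∀ u v → Dec (P u v)) {u v} →
                      P u v → Ac u v ≡ true → x (inner u) (inner v) ≡ true → checkCount d u v ≡ 1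
    checkCount-flow d {u} {v} Puv Acuv xuv rewrite Acuv | dec-true (d u v) Puv | xuv = refl

    module _ (decM : ∀ u v → Dec (InMinus A Ac T u v))
             (decP : ∀ u v → Dec (InPlus A Ac T u v)) where

      private
        bothCounts : Fin n × Fin n → ℕ
        bothCounts (u , v) = checkCount decM u v ℕ.+ checkCount decP u v

        chosenArc-counted : ∀ {i} → i ∈ˢ T → (c : CheckArc (Around i)) → 1 ℕ.≤ bothCounts (arcOf c)
        chosenArc-counted {i} i∈T (checkArc {u} {v} Acuv u→v (inj₁ v→i)) =
          subst (λ k → 1 ℕ.≤ k ℕ.+ checkCount decP u v)
                (sym (checkCount-flow decM (i , i∈T , flow-reach v→i) Acuv (proj₂ u→v)))
                (ℕ.m≤m+n 1 (checkCount decP u v))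
        chosenArc-counted {i} i∈T (checkArc {u} {v} Acuv u→v (inj₂ i→u)) =
          subst (λ k → 1 ℕ.≤ checkCount decM u v ℕ.+ k)
                (sym (checkCount-flow decP (i , i∈T , flow-reach i→u) Acuv (proj₂ u→v)))
                (ℕ.m≤n+m 1 (checkCount decM u v))

      weight-≤-counts : sumℕ (allFin n) weight ℕ.≤ countWhere decM ℕ.+ countWhere decP
      weight-≤-counts = begin
        sumℕ (allFin n) weight
          ≤⟨ sumℕ-≤-injection (×-≡-dec Fin._≟_ Fin._≟_) weight bothCounts assigned
               (allFin n) pairs (allFin⁺ n)
               (λ i w≢0 → ∈-cartesianProduct⁺ (∈-allFin _) (∈-allFin _))
               (λ i w≢0 → let (i∈T , in≢0) = weight-nonzero i w≢0 in
                 ℕ.≤-trans (weight≤1 i) (chosenArc-counted i∈T (chosenArc i in≢0)))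
               (λ i j w≢0 w′≢0 → chosenArc-injective (proj₁ (weight-nonzero i w≢0))
                                   (proj₁ (weight-nonzero j w′≢0)) _ _) ⟩
        sumℕ pairs bothCounts
          ≡⟨ Σℕ.sum-cartesianProduct (allFin n) (allFin n) bothCounts ⟩
        sumℕ (allFin n) (λ u → sumℕ (allFin n) λ v → checkCount decM u v ℕ.+ checkCount decP u v)
          ≡⟨ Σℕ.sum-cong (allFin n) (λ u →
               Σℕ.sum-distrib (allFin n) (checkCount decM u) (checkCount decP u)) ⟩
        sumℕ (allFin n) (λ u →
          sumℕ (allFin n) (checkCount decM u) ℕ.+ sumℕ (allFin n) (checkCount decP u))
          ≡⟨ Σℕ.sum-distrib (allFin n) _ _ ⟩
        countWhere decM ℕ.+ countWhere decP ∎
        where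
          open ℕ.≤-Reasoning
          pairs = cartesianProduct (allFin n) (allFin n)

      private
        toℚ-inFlow : ∀ i → toℚ (inF i) ≡ zval A (embed x) i
        toℚ-inFlow i = trans (toℚ-sumℕ nodes (λ u → b2n (isArc A u (inner i) ∧ x u (inner i))))
          (Σℚ.sum-cong nodes λ u → trans (toℚ-b2n (isArc A u (inner i) ∧ x u (inner i)))
                                         (b2q-∧ (isArc A u (inner i)) (x u (inner i))))

        toℚ-weight : toℚ (sumℕ (allFin n) weight) ≡ zSum A T (embed x)
        toℚ-weight = trans (toℚ-sumℕ (allFin n) weight) (Σℚ.sum-cong (allFin n) λ i →
          trans (toℚ-if (does (i ∈? T)) (inF i))
                (cong (if does (i ∈? T) then_else 0ℚ) (toℚ-inFlow i)))

        toℚ-countWhere : ∀ {P : Fin n → Fin n → Set} (d : ∀ u v → Dec (P u v)) →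
                         toℚ (countWhere d) ≡ sumCheckWhere A Ac d (embed x)
        toℚ-countWhere d = trans (toℚ-sumℕ (allFin n) _) (Σℚ.sum-cong (allFin n) λ u →
          trans (toℚ-sumℕ (allFin n) _) (Σℚ.sum-cong (allFin n) λ v →
            trans (toℚ-if (Ac u v ∧ does (d u v)) _)
                  (cong (if Ac u v ∧ does (d u v) then_else 0ℚ) (toℚ-b2n (x (inner u) (inner v))))))

      binary-valid : zSum A T (embed x) ≤
                     sumCheckWhere A Ac decM (embed x) + sumCheckWhere A Ac decP (embed x)
      binary-valid = subst₂ _≤_ toℚ-weight
        (trans (toℚ-+ (countWhere decM) (countWhere decP))
               (cong₂ _+_ (toℚ-countWhere decM) (toℚ-countWhere decP)))
        (toℚ-mono weight-≤-counts)

proposition6 : ∀ {n : ℕ} (A Ac : Fin n → Fin n → Bool) →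
  (∀ i j → Ac i j ≡ true → A i j ≡ true) →
  Acyclic A →
  (T : Subset n) → Conflicting A T →
  (y : Node n → Node n → ℚ) → InP A Ac y →
  (decM : ∀ u v → Dec (InMinus A Ac T u v)) →
  (decP : ∀ u v → Dec (InPlus A Ac T u v)) →
  zSum A T y ≤ sumCheckWhere A Ac decM y + sumCheckWhere A Ac decP y
proposition6 A Ac Ac⊆A acyclic T conflicting y y∈𝒫 decM decP =
  valid-on-hull A Ac (zSum-arcLinear A Ac T)
    (sumCheckWhere-arcLinear A Ac Ac⊆A decM) (sumCheckWhere-arcLinear A Ac Ac⊆A decP)
    (λ x feasible → FlowPaths.binary-valid A Ac acyclic x feasible T conflicting decM decP)
    y y∈𝒫
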